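{- Let $G$ be a graph, let $\mathcal{S}$ be a separation algorithm and $g$ a threshold function, and let $\mathcal{T}_{\mathsf{sep}}$ be the binary separation tree of $G$ with respect to $\mathcal{S}$ and $g$. Let $n\ge 1$ and let $w_1,\dots,w_n$ be nodes of $\mathcal{T}_{\mathsf{sep}}$ such that $w_1=\varepsilon$ is the root, $w_{i+1}$ is a child of $w_i$ (i.e. $w_{i+1}=w_i\cdot b_i$ with $b_i\in\{0,1\}$) for $1\le i<n$, and each $w_i$ is an internal node. Suppose a robber is on some vertex of $G$ and there is a cop on each vertex of $\bigcup_{i=1}^n \operatorname{Sep}(w_i)$. Then a robber in the set $w_n\cdot 1$, respectively in the set $w_n\cdot 0$, cannot leave that set without being caught.
   Context: Graphs are finite, simple, undirected; for $S\subseteq V(G)$, $G[S]$ is the induced subgraph. A separation algorithm $\mathcal{S}$ takes a graph $H$ and returns a partition $(A,B,C)$ of $V(H)$ into pairwise disjoint sets with no edge between $A$ and $B$ ($C$ is the separator, $A,B$ the separated sets; in the tree construction $|A|,|B|\le \frac23|V(H)|$). The binary separation tree $\mathcal{T}_{\mathsf{sep}}$ of an $n$-vertex graph $G$ with respect to $\mathcal{S}$ and a threshold function $g$: its nodes are subsets of $V(G)$ indexed by binary strings; the root $\varepsilon$ (empty string) is $V(G)$; if a node $\omega$ has $|\omega|>g(n)$, apply $\mathcal{S}$ to $G[\omega]$ to obtain $(A_\omega,B_\omega,C_\omega)$, and the children of $\omega$ are $\omega\cdot 1:=A_\omega$ and $\omega\cdot 0:=B_\omega$, while $\operatorname{Sep}(\omega):=C_\omega$;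 a node $\omega$ with $|\omega|\le g(n)$ is a leaf. The game is the zero-visibility Cops and Robbers game: cops and robber alternately move to a vertex of their closed neighbourhood, the robber is invisible to cops, and the robber is caught when a cop occupies its vertex. -}

module Defs where

open import Data.Nat using (ℕ; zero; suc; _+_; _*_; _≤_; _<_)
open import Data.Bool using (Bool; true; false; _∧_; _∨_; if_then_else_)
open import Data.Fin using (Fin; zero; suc; _≟_)
open import Data.Fin.Subset using (Subset; ∣_∣; ⊤)
open import Data.Fin.Subset.Properties using (_∈?_)
open import Data.List using (List; []; _∷_; length; lookup; filter; allFin)
open import Data.Vec using (tabulate)
open import Relation.Nullary using (does)
open import Relation.Binary.PropositionalEquality using (_≡_)

record Graph (m : ℕ) : Set where
  field
    adj    : Fin m → Fin m → Bool
    sym    : ∀ u v → adj u v ≡ adj v u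
    irrefl : ∀ v → adj v v ≡ false

data Side : Set where
  sideA sideB sideC : Side

isA isB isC : Side → Bool
isA sideA = true
isA _     = false
isB sideB = true
isB _     = false
isC sideC = true
isC _     = false

anyFin : ∀ {m} → (Fin m → Bool) → Bool
anyFin {zero}  p = false
anyFin {suc m} p = p zero ∨ anyFin (λ i → p (suc i))

countFin : ∀ {m} → (Fin m → Bool) → ℕ
countFin {zero}  p = 0
countFin {suc m} p = (if p zero then 1 else 0) + countFin (λ i → p (suc i))

-- A separation algorithm: to every graph H it assigns a partition (A,B,C)
-- of V(H) (encoded as a map V(H) → Side, so the parts are pairwise disjoint
-- and cover V(H)), with no edge between A and B, and |A|,|B| ≤ 2/3 |V(H)|.
record SepAlg : Set where
  field
    sep       : ∀ {m} → Graph m → Fin m → Side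
    noEdge    : ∀ {m} (H : Graph m) (u v : Fin m) →
                sep H u ≡ sideA → sep H v ≡ sideB → Graph.adj H u v ≡ false
    balancedA : ∀ {m} (H : Graph m) → 3 * countFin (λ v → isA (sep H v)) ≤ 2 * m
    balancedB : ∀ {m} (H : Graph m) → 3 * countFin (λ v → isB (sep H v)) ≤ 2 * m

-- Induced subgraph G[ω], with vertices the elements of ω listed in increasing order.
elems : ∀ {N} → Subset N → List (Fin N)
elems {N} ω = filter (λ x → x ∈? ω) (allFin N)

size : ∀ {N} → Subset N → ℕ
size ω = length (elems ω)

emb : ∀ {N} (ω : Subset N) → Fin (size ω) → Fin N
emb ω = lookup (elems ω)

induced : ∀ {N} → Graph N → (ω : Subset N) → Graph (size ω)
induced G ω = record
  { adj    = λ i j → Graph.adj G (emb ω i) (emb ω j)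
  ; sym    = λ i j → Graph.sym G (emb ω i) (emb ω j)
  ; irrefl = λ i → Graph.irrefl G (emb ω i)
  }

-- The binary separation tree of G w.r.t. S and threshold g.
-- Binary strings are lists of bits b₁ b₂ … b_k (first bit = first step from the root);
-- ω · b corresponds to appending b at the end.
module Tree {N : ℕ} (G : Graph N) (S : SepAlg) (g : ℕ → ℕ) where

  -- the partition S(G[ω]) pulled back to subsets of V(G)
  part : Subset N → (Side → Bool) → Subset N
  part ω t = tabulate λ v →
    anyFin λ i → does (emb ω i ≟ v) ∧ t (SepAlg.sep S (induced G ω) i)

  child : Subset N → Bool → Subset N
  child ω b = part ω (if b then isA else isB)

  Sep : Subset N → Subset N
  Sep ω = part ω isC

  nodeFrom : Subset N → List Bool → Subset N
  nodeFrom ω []       = ω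
  nodeFrom ω (b ∷ bs) = nodeFrom (child ω b) bs

  node : List Bool → Subset N
  node = nodeFrom ⊤

  Internal : Subset N → Set
  Internal ω = g N < ∣ ω ∣

module Submission where

-- The separator splits G[ω] into ω·1 = A_ω, ω·0 = B_ω and Sep(ω) with no edge between
-- the two halves, so a neighbour of ω·b that lies in ω lies in ω·b or in Sep(ω).
-- Walking down the path w₁, …, w_n, a neighbour v of w_n·b outside w_n·b therefore drops
-- out of the path at some w_k and lies in Sep(w_k). The first step of the robber out of
-- w_n·b lands on such a vertex, where a cop sits.

open import Defs
open import Data.Nat using (ℕ; zero; suc; _≤_; _<_; z≤n; s≤s)
open import Data.Nat.Properties using (≤-refl; m<n⇒m<1+n)
open import Data.Bool using (Bool; true; false; T; if_then_else_)
open import Data.Bool.Properties using (T-≡; T-∧; T-∨)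
open import Data.Fin using (Fin; zero; suc; _≟_)
open import Data.Fin.Subset using (Subset; _∈_; _∉_; _⊆_; ⊤)
open import Data.Fin.Subset.Properties using (_∈?_; ∈⊤)
open import Data.List using (List; []; _∷_; length; take; allFin)
open import Data.List.Relation.Unary.Any using (index)
open import Data.List.Relation.Unary.Any.Properties using (lookup-index)
open import Data.List.Membership.Propositional.Properties
  using (∈-filter⁺; ∈-filter⁻; ∈-lookup; ∈-allFin)
open import Data.Vec using (tabulate)
open import Data.Vec.Properties using ([]=⇒lookup; lookup⇒[]=; lookup∘tabulate)
open import Data.Product using (∃; _×_; _,_; proj₂)
open import Data.Sum using (_⊎_; inj₁; inj₂; map₂)
open import Data.Empty using (⊥-elim)
open import Function.Bundles using (Equivalence)
open import Relation.Nullary using (¬_; does; yes; no; contradiction)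
open import Relation.Nullary.Decidable using (dec-true)
open import Relation.Unary using (Decidable)
open import Relation.Binary.PropositionalEquality using (_≡_; refl; sym; trans; subst)

open Equivalence using (to; from)

first-exit : ∀ {p} {P : ℕ → Set p} → Decidable P → P 0 →
             ∀ t → ¬ P t → ∃ λ s → s < t × P s × ¬ P (suc s)
first-exit P? P0 zero ¬P0 = contradiction P0 ¬P0
first-exit P? P0 (suc t) ¬Pt+1 with P? t
... | yes Pt = t , ≤-refl , Pt , ¬Pt+1
... | no ¬Pt with first-exit P? P0 t ¬Pt
...   | s , s<t , exit = s , m<n⇒m<1+n s<t , exit

∈-tabulate⁻ : ∀ {m} (f : Fin m → Bool) {v} → v ∈ tabulate f → T (f v)
∈-tabulate⁻ f {v} v∈ = from T-≡ (trans (sym (lookup∘tabulate f v)) ([]=⇒lookup v∈))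

∈-tabulate⁺ : ∀ {m} (f : Fin m → Bool) {v} → T (f v) → v ∈ tabulate f
∈-tabulate⁺ f {v} fv = lookup⇒[]= v (tabulate f) (trans (lookup∘tabulate f v) (to T-≡ fv))

anyFin⁻ : ∀ {m} (p : Fin m → Bool) → T (anyFin p) → ∃ λ i → T (p i)
anyFin⁻ {suc m} p any with to T-∨ any
... | inj₁ p0   = zero , p0
... | inj₂ rest with anyFin⁻ (λ i → p (suc i)) rest
...   | i , pi = suc i , pi

anyFin⁺ : ∀ {m} (p : Fin m → Bool) i → T (p i) → T (anyFin p)
anyFin⁺ p zero    pi = from T-∨ (inj₁ pi)
anyFin⁺ p (suc i) pi = from T-∨ (inj₂ (anyFin⁺ (λ j → p (suc j)) i pi))

≟-sound : ∀ {m} {x y : Fin m} → T (does (x ≟ y)) → x ≡ y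
≟-sound {x = x} {y} x≟y with x ≟ y
... | yes x≡y = x≡y

emb-∈ : ∀ {N} (ω : Subset N) i → emb ω i ∈ ω
emb-∈ {N} ω i = proj₂ (∈-filter⁻ (_∈? ω) {xs = allFin N} (∈-lookup i))

emb-onto : ∀ {N} (ω : Subset N) {v} → v ∈ ω → ∃ λ i → emb ω i ≡ v
emb-onto ω {v} v∈ω = index v∈elems , sym (lookup-index v∈elems)
  where v∈elems = ∈-filter⁺ (_∈? ω) (∈-allFin v) v∈ω

module _ {N : ℕ} (G : Graph N) (S : SepAlg) (g : ℕ → ℕ) where
  open Tree G S g
  open Graph G using (adj)

  side : (ω : Subset N) → Fin (size ω) → Side
  side ω = SepAlg.sep S (induced G ω)

  ∈-part⁻ : ∀ ω t {v} → v ∈ part ω t → ∃ λ i → emb ω i ≡ v × T (t (side ω i))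
  ∈-part⁻ ω t {v} v∈ with anyFin⁻ _ (∈-tabulate⁻ _ v∈)
  ... | i , hit with to T-∧ hit
  ... | is-v , ti = i , ≟-sound is-v , ti

  ∈-part⁺ : ∀ ω t {i s} → side ω i ≡ s → T (t s) → emb ω i ∈ part ω t
  ∈-part⁺ ω t {i} refl ts =
    ∈-tabulate⁺ _ (anyFin⁺ _ i (from T-∧ (i≟i , ts)))
    where i≟i = from T-≡ (dec-true (emb ω i ≟ emb ω i) refl)

  isChild : Bool → Side → Bool
  isChild b = if b then isA else isB

  part⊆ : ∀ ω t → part ω t ⊆ ω
  part⊆ ω t v∈ with ∈-part⁻ ω t v∈
  ... | i , refl , _ = emb-∈ ω i

  nodeFrom⊆ : ∀ ω bs → nodeFrom ω bs ⊆ ω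
  nodeFrom⊆ ω []       v∈ = v∈
  nodeFrom⊆ ω (c ∷ bs) v∈ = part⊆ ω (isChild c) (nodeFrom⊆ (child ω c) bs v∈)

  no-AB-edge : ∀ ω {i j} → side ω i ≡ sideA → side ω j ≡ sideB →
               ¬ adj (emb ω i) (emb ω j) ≡ true
  no-AB-edge ω {i} {j} si sj ij =
    contradiction (trans (sym ij) (SepAlg.noEdge S (induced G ω) i j si sj)) λ ()

  child-boundary : ∀ ω c {u v} → u ∈ child ω c → adj u v ≡ true → v ∈ ω →
                   v ∈ child ω c ⊎ v ∈ Sep ω
  child-boundary ω c u∈ uv v∈ with ∈-part⁻ ω (isChild c) u∈ | emb-onto ω v∈
  ... | i , refl , ti | j , refl with c | side ω i in si | side ω j in sj
  ... | _     | _     | sideC = inj₂ (∈-part⁺ ω isC sj _)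
  ... | true  | sideA | sideA = inj₁ (∈-part⁺ ω isA sj _)
  ... | false | sideB | sideB = inj₁ (∈-part⁺ ω isB sj _)
  ... | true  | sideA | sideB = ⊥-elim (no-AB-edge ω si sj uv)
  ... | false | sideB | sideA = ⊥-elim (no-AB-edge ω sj si (trans (Graph.sym G _ _) uv))
  ... | true  | sideB | _ = ⊥-elim ti
  ... | true  | sideC | _ = ⊥-elim ti
  ... | false | sideA | _ = ⊥-elim ti
  ... | false | sideC | _ = ⊥-elim ti

  path-child-boundary : ∀ ω bs b {u v} → u ∈ child (nodeFrom ω bs) b → adj u v ≡ true →
    v ∈ ω → v ∈ child (nodeFrom ω bs) b ⊎
            ∃ λ k → k ≤ length bs × v ∈ Sep (nodeFrom ω (take k bs))
  path-child-boundary ω [] b u∈ uv v∈ =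
    map₂ (λ v∈Sep → 0 , z≤n , v∈Sep) (child-boundary ω b u∈ uv v∈)
  path-child-boundary ω (c ∷ bs) b u∈ uv v∈
    with child-boundary ω c (nodeFrom⊆ (child ω c) bs (part⊆ _ (isChild b) u∈)) uv v∈
  ... | inj₂ v∈Sep = inj₂ (0 , z≤n , v∈Sep)
  ... | inj₁ v∈c   = map₂ (λ { (k , k≤ , v∈Sep) → suc k , s≤s k≤ , v∈Sep })
                          (path-child-boundary (child ω c) bs b u∈ uv v∈c)

lemma1 : ∀ {N : ℕ} (G : Graph N) (S : SepAlg) (g : ℕ → ℕ) (bs : List Bool) →
    (∀ k → k ≤ length bs → Tree.Internal G S g (Tree.node G S g (take k bs))) →
    (cops : Subset N) →
    (∀ k v → k ≤ length bs → v ∈ Tree.Sep G S g (Tree.node G S g (take k bs)) → v ∈ cops) →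
    (b : Bool) (r : ℕ → Fin N) →
    (∀ t → r (suc t) ≡ r t ⊎ Graph.adj G (r t) (r (suc t)) ≡ true) →
    r 0 ∈ Tree.child G S g (Tree.node G S g bs) b →
    ∀ t → r t ∉ Tree.child G S g (Tree.node G S g bs) b →
    ∃ λ s → s ≤ t × r s ∈ cops
lemma1 G S g bs _ cops guarded b r walk r0∈ t rt∉
  with first-exit (λ s → r s ∈? Tree.child G S g (Tree.node G S g bs) b) r0∈ t rt∉
... | s , s<t , rs∈ , rs+1∉ with walk s
...   | inj₁ stay = contradiction (subst (_∈ _) (sym stay) rs∈) rs+1∉
...   | inj₂ step with path-child-boundary G S g ⊤ bs b rs∈ step ∈⊤
...     | inj₁ back                = contradiction back rs+1∉
...     | inj₂ (k , k≤ , rs+1∈Sep) = suc s , s<t , guarded k _ k≤ rs+1∈Sep
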